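{- Assume $A\neq 0$. For every integer $n$ let $x_n=h_{n+1}-qh_{n-1}$. Then for all integers $n$ and $k$, $$\left(\frac{x_n+h_n d}{2Ad}\right)^k=\frac{x_{kn}+h_{kn}d}{2Ad}.$$
   Context: Let $a,b,p,q$ be complex numbers with $q\neq 0$ and $p^2-4q\neq 0$. Let $d$ be a fixed square root of $p^2-4q$, $\alpha=(p+d)/2$, $\beta=(p-d)/2$, and $A=b-a\beta$. The Horadam-Lucas sequence $(h_n)_{n\in\mathbb{Z}}$ is defined by $h_0=2b-ap$, $h_1=bp-2aq$, and $h_n=ph_{n-1}-qh_{n-2}$ for all integers $n$ (for negative indices, via $h_{n-2}=(ph_{n-1}-h_n)/q$). -}

module Defs where

open import Level using (Level; _⊔_) renaming (suc to lsuc)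
open import Data.Nat using (ℕ; zero; suc)
open import Data.Integer using (ℤ; +_; -[1+_])
open import Data.Product using (_×_; _,_; proj₁)
open import Algebra.Bundles using (CommutativeRing)
open import Relation.Nullary using (¬_)

record Field (c ℓ : Level) : Set (lsuc (c ⊔ ℓ)) where
  field
    commutativeRing : CommutativeRing c ℓ
  open CommutativeRing commutativeRing public
  field
    _⁻¹     : Carrier → Carrier
    ⁻¹-cong : ∀ {x y} → x ≈ y → x ⁻¹ ≈ y ⁻¹
    inverseʳ : ∀ x → ¬ (x ≈ 0#) → x * x ⁻¹ ≈ 1#
    0≉1     : ¬ (0# ≈ 1#)

module FieldOps {c ℓ} (F : Field c ℓ) where
  open Field F

  infixl 7 _/_
  _/_ : Carrier → Carrier → Carrier
  x / y = x * y ⁻¹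

  fromℕ : ℕ → Carrier
  fromℕ zero    = 0#
  fromℕ (suc n) = 1# + fromℕ n

  _^ℕ_ : Carrier → ℕ → Carrier
  x ^ℕ zero  = 1#
  x ^ℕ suc n = x * (x ^ℕ n)

  _^ℤ_ : Carrier → ℤ → Carrier
  x ^ℤ (+ n)     = x ^ℕ n
  x ^ℤ -[1+ m ]  = (x ⁻¹) ^ℕ suc m

  CharacteristicZero : Set ℓ
  CharacteristicZero = ∀ n → ¬ (fromℕ (suc n) ≈ 0#)

module HoradamLucas {c ℓ} (F : Field c ℓ) (a b p q : Field.Carrier F) where
  open Field F
  open FieldOps F

  h₀ h₁ : Carrier
  h₀ = fromℕ 2 * b - a * p
  h₁ = b * p - fromℕ 2 * a * q

  fwd : ℕ → Carrier × Carrier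
  fwd zero    = h₀ , h₁
  fwd (suc n) with fwd n
  ... | (u , v) = v , p * v - q * u

  -- backward pairs (h_{-m} , h_{-m+1}), using h_{n-2} = (p h_{n-1} - h_n)/q
  bwd : ℕ → Carrier × Carrier
  bwd zero    = h₀ , h₁
  bwd (suc m) with bwd m
  ... | (u , v) = (p * u - v) / q , u

  h : ℤ → Carrier
  h (+ n)      = proj₁ (fwd n)
  h -[1+ m ]   = proj₁ (bwd (suc m))

{-# OPTIONS --safe #-}
-- With α, β the roots of X² − pX + q and B = b − aα, the Binet formula h n = A αⁿ + B βⁿ holds
-- for every integer n: both sides solve the recurrence (α and β are units since αβ = q ≠ 0)
-- and agree at 0 and 1. Because q/α = β and q/β = α, it gives x n = (α − β)(A αⁿ − B βⁿ),
-- so x n + h n d = 2Ad αⁿ. Thus the quotient in the statement is αⁿ, and the claim is the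
-- power law (αⁿ)ᵏ = αᵏⁿ in the unit group.
module Submission where

open import Defs
open import Data.Integer as ℤ using (ℤ; +_; -[1+_]; _⊖_; sign; ∣_∣)
import Data.Integer.Properties as ℤP
open import Data.Nat as ℕ using (ℕ; zero; suc)
import Data.Nat.Properties as ℕP
open import Data.Sign as Sign using (Sign)
open import Data.Maybe using (Maybe; just; nothing)
open import Relation.Binary.PropositionalEquality as ≡ using (_≡_)
open import Relation.Nullary using (¬_; yes; no)
open import Algebra.Bundles using (CommutativeRing)
import Algebra.Solver.Ring.AlmostCommutativeRing as ACR

-- The ring solver needs integer coefficients, hence the canonical map ℤ → R; on numerals it is
-- definitionally fromℕ, so solver goals mentioning fromℕ 2 or fromℕ 4 close by refl.
module IntegerCoefficients {c ℓ} (R : CommutativeRing c ℓ) where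
  open CommutativeRing R
  open import Algebra.Properties.Ring ring
  open import Algebra.Properties.Semiring.Mult semiring using (_×_; ×-homo-+; ×1-homo-*)
  open import Algebra.Properties.CommutativeSemigroup *-commutativeSemigroup using (interchange)
  open import Relation.Binary.Reasoning.Setoid setoid

  ⟦_⟧ℤ : ℤ → Carrier
  ⟦ + n ⟧ℤ      = n × 1#
  ⟦ -[1+ n ] ⟧ℤ = - (suc n × 1#)

  ⟦⊖⟧ : ∀ m n → ⟦ m ⊖ n ⟧ℤ ≈ m × 1# - n × 1#
  ⟦⊖⟧ m       zero    = sym (trans (+-congˡ -0#≈0#) (+-identityʳ _))
  ⟦⊖⟧ zero    (suc n) = sym (+-identityˡ _)
  ⟦⊖⟧ (suc m) (suc n) = begin
    ⟦ suc m ⊖ suc n ⟧ℤ                ≡⟨ ≡.cong ⟦_⟧ℤ (ℤP.[1+m]⊖[1+n]≡m⊖n m n) ⟩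
    ⟦ m ⊖ n ⟧ℤ                        ≈⟨ ⟦⊖⟧ m n ⟩
    m × 1# - n × 1#                   ≈⟨ xyx⁻¹≈y 1# (m × 1# - n × 1#) ⟨
    1# + (m × 1# - n × 1#) - 1#       ≈⟨ +-congʳ (+-assoc _ _ _) ⟨
    1# + m × 1# - n × 1# - 1#         ≈⟨ +-assoc _ _ _ ⟩
    1# + m × 1# + (- n × 1# - 1#)     ≈⟨ +-congˡ (trans (+-comm _ _) (-‿+-comm 1# (n × 1#))) ⟩
    suc m × 1# - suc n × 1#           ∎

  ⟦-⟧ : ∀ i → ⟦ ℤ.- i ⟧ℤ ≈ - ⟦ i ⟧ℤ
  ⟦-⟧ -[1+ n ]  = sym (-‿involutive _)
  ⟦-⟧ (+ zero)  = sym -0#≈0#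
  ⟦-⟧ (+ suc n) = refl

  ⟦+⟧ : ∀ i j → ⟦ i ℤ.+ j ⟧ℤ ≈ ⟦ i ⟧ℤ + ⟦ j ⟧ℤ
  ⟦+⟧ -[1+ m ] -[1+ n ] = begin
    - (suc (suc (m ℕ.+ n)) × 1#)       ≡⟨ ≡.cong (λ k → - (suc k × 1#)) (ℕP.+-suc m n) ⟨
    - ((suc m ℕ.+ suc n) × 1#)         ≈⟨ -‿cong (×-homo-+ 1# (suc m) (suc n)) ⟩
    - (suc m × 1# + suc n × 1#)        ≈⟨ -‿+-comm _ _ ⟨
    - (suc m × 1#) + - (suc n × 1#)    ∎
  ⟦+⟧ -[1+ m ] (+ n)    = trans (⟦⊖⟧ n (suc m)) (+-comm _ _)
  ⟦+⟧ (+ m)    -[1+ n ] = ⟦⊖⟧ m (suc n)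
  ⟦+⟧ (+ m)    (+ n)    = ×-homo-+ 1# m n

  ⟦_⟧ₛ : Sign → Carrier
  ⟦ Sign.+ ⟧ₛ = 1#
  ⟦ Sign.- ⟧ₛ = - 1#

  ⟦◃⟧ : ∀ s n → ⟦ s ℤ.◃ n ⟧ℤ ≈ ⟦ s ⟧ₛ * n × 1#
  ⟦◃⟧ s      zero    = sym (zeroʳ _)
  ⟦◃⟧ Sign.+ (suc n) = sym (*-identityˡ _)
  ⟦◃⟧ Sign.- (suc n) = sym (-1*x≈-x _)

  ⟦⟧ₛ-homo : ∀ s t → ⟦ s Sign.* t ⟧ₛ ≈ ⟦ s ⟧ₛ * ⟦ t ⟧ₛ
  ⟦⟧ₛ-homo Sign.+ t      = sym (*-identityˡ _)
  ⟦⟧ₛ-homo Sign.- Sign.+ = sym (*-identityʳ _)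
  ⟦⟧ₛ-homo Sign.- Sign.- = sym (trans (-1*x≈-x _) (-‿involutive _))

  ⟦*⟧ : ∀ i j → ⟦ i ℤ.* j ⟧ℤ ≈ ⟦ i ⟧ℤ * ⟦ j ⟧ℤ
  ⟦*⟧ i j = begin
    ⟦ sign i Sign.* sign j ℤ.◃ ∣ i ∣ ℕ.* ∣ j ∣ ⟧ℤ           ≈⟨ ⟦◃⟧ (sign i Sign.* sign j) (∣ i ∣ ℕ.* ∣ j ∣) ⟩
    ⟦ sign i Sign.* sign j ⟧ₛ * (∣ i ∣ ℕ.* ∣ j ∣) × 1#     ≈⟨ *-cong (⟦⟧ₛ-homo (sign i) (sign j)) (×1-homo-* ∣ i ∣ ∣ j ∣) ⟩
    ⟦ sign i ⟧ₛ * ⟦ sign j ⟧ₛ * (∣ i ∣ × 1# * ∣ j ∣ × 1#)  ≈⟨ interchange _ _ _ _ ⟩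
    ⟦ sign i ⟧ₛ * ∣ i ∣ × 1# * (⟦ sign j ⟧ₛ * ∣ j ∣ × 1#)  ≈⟨ *-cong (⟦◃⟧ (sign i) ∣ i ∣) (⟦◃⟧ (sign j) ∣ j ∣) ⟨
    ⟦ sign i ℤ.◃ ∣ i ∣ ⟧ℤ * ⟦ sign j ℤ.◃ ∣ j ∣ ⟧ℤ          ≡⟨ ≡.cong₂ (λ i j → ⟦ i ⟧ℤ * ⟦ j ⟧ℤ) (ℤP.◃-inverse i) (ℤP.◃-inverse j) ⟩
    ⟦ i ⟧ℤ * ⟦ j ⟧ℤ                                       ∎

  ⟦⟧ℤ-homomorphism : ℤ.+-*-rawRing ACR.-Raw-AlmostCommutative⟶ ACR.fromCommutativeRing R
  ⟦⟧ℤ-homomorphism = record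
    { ⟦_⟧ = ⟦_⟧ℤ ; +-homo = ⟦+⟧ ; *-homo = ⟦*⟧ ; -‿homo = ⟦-⟧ ; 0-homo = refl ; 1-homo = +-identityʳ 1# }

  ⟦⟧ℤ-≟ : ∀ i j → Maybe (⟦ i ⟧ℤ ≈ ⟦ j ⟧ℤ)
  ⟦⟧ℤ-≟ i j with i ℤ.≟ j
  ... | yes ≡.refl = just refl
  ... | no _       = nothing

  open import Algebra.Solver.Ring ℤ.+-*-rawRing (ACR.fromCommutativeRing R) ⟦⟧ℤ-homomorphism ⟦⟧ℤ-≟ public

module _ {c ℓ} (F : Field c ℓ) where
  open Field F
  open FieldOps F
  open IntegerCoefficients commutativeRing
  open import Algebra.Properties.Semiring.Exp semiring using (_^_; ^-congˡ; ^-homo-*)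
  open import Algebra.Properties.CommutativeSemigroup *-commutativeSemigroup
    using (interchange; xy∙z≈y∙xz)
  open import Relation.Binary.Reasoning.Setoid setoid

  x*y/x≈y : ∀ {x} y → ¬ (x ≈ 0#) → x * y / x ≈ y
  x*y/x≈y {x} y x≉0 = begin
    x * y * x ⁻¹    ≈⟨ xy∙z≈y∙xz x y (x ⁻¹) ⟩
    y * (x * x ⁻¹)  ≈⟨ *-congˡ (inverseʳ x x≉0) ⟩
    y * 1#          ≈⟨ *-identityʳ y ⟩
    y               ∎

  x*y≉0⇒x≉0 : ∀ {x y} → ¬ (x * y ≈ 0#) → ¬ (x ≈ 0#)
  x*y≉0⇒x≉0 {x} {y} x*y≉0 x≈0 = x*y≉0 (trans (*-congʳ x≈0) (zeroˡ y))

  x≉0∧y≉0⇒x*y≉0 : ∀ {x y} → ¬ (x ≈ 0#) → ¬ (y ≈ 0#) → ¬ (x * y ≈ 0#)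
  x≉0∧y≉0⇒x*y≉0 {x} {y} x≉0 y≉0 x*y≈0 = y≉0 (begin
    y             ≈⟨ x*y/x≈y y x≉0 ⟨
    x * y * x ⁻¹  ≈⟨ *-congʳ x*y≈0 ⟩
    0# * x ⁻¹     ≈⟨ zeroˡ (x ⁻¹) ⟩
    0#            ∎)

  inverseʳ-unique : ∀ x y → x * y ≈ 1# → y ≈ x ⁻¹
  inverseʳ-unique x y x*y≈1 = begin
    y             ≈⟨ x*y/x≈y y x≉0 ⟨
    x * y * x ⁻¹  ≈⟨ *-congʳ x*y≈1 ⟩
    1# * x ⁻¹     ≈⟨ *-identityˡ (x ⁻¹) ⟩
    x ⁻¹          ∎
    where
    x≉0 : ¬ (x ≈ 0#)
    x≉0 x≈0 = 0≉1 (trans (sym (zeroˡ y)) (trans (*-congʳ (sym x≈0)) x*y≈1))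

  ^ℕ≈^ : ∀ x n → x ^ℕ n ≈ x ^ n
  ^ℕ≈^ x zero    = refl
  ^ℕ≈^ x (suc n) = *-congˡ (^ℕ≈^ x n)

  ^ℕ-cong : ∀ {x y} n → x ≈ y → x ^ℕ n ≈ y ^ℕ n
  ^ℕ-cong {x} {y} n x≈y = trans (^ℕ≈^ x n) (trans (^-congˡ n x≈y) (sym (^ℕ≈^ y n)))

  ^ℕ-+ : ∀ x m n → x ^ℕ (m ℕ.+ n) ≈ x ^ℕ m * x ^ℕ n
  ^ℕ-+ x m n = begin
    x ^ℕ (m ℕ.+ n)     ≈⟨ ^ℕ≈^ x (m ℕ.+ n) ⟩
    x ^ (m ℕ.+ n)      ≈⟨ ^-homo-* x m n ⟩
    x ^ m * x ^ n      ≈⟨ *-cong (^ℕ≈^ x m) (^ℕ≈^ x n) ⟨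
    x ^ℕ m * x ^ℕ n    ∎

  ^ℤ-cong : ∀ {x y} k → x ≈ y → x ^ℤ k ≈ y ^ℤ k
  ^ℤ-cong (+ n)     x≈y = ^ℕ-cong n x≈y
  ^ℤ-cong -[1+ n ]  x≈y = ^ℕ-cong (suc n) (⁻¹-cong x≈y)

  module UnitPowers {u} (u≉0 : ¬ (u ≈ 0#)) where

    ^ℤ-⊖ : ∀ m n → u ^ℤ (m ⊖ n) ≈ u ^ℕ m * (u ⁻¹) ^ℕ n
    ^ℤ-⊖ m       zero    = sym (*-identityʳ _)
    ^ℤ-⊖ zero    (suc n) = sym (*-identityˡ _)
    ^ℤ-⊖ (suc m) (suc n) = begin
      u ^ℤ (suc m ⊖ suc n)               ≡⟨ ≡.cong (u ^ℤ_) (ℤP.[1+m]⊖[1+n]≡m⊖n m n) ⟩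
      u ^ℤ (m ⊖ n)                       ≈⟨ ^ℤ-⊖ m n ⟩
      u ^ℕ m * (u ⁻¹) ^ℕ n               ≈⟨ *-identityˡ _ ⟨
      1# * (u ^ℕ m * (u ⁻¹) ^ℕ n)        ≈⟨ *-congʳ (inverseʳ u u≉0) ⟨
      u * u ⁻¹ * (u ^ℕ m * (u ⁻¹) ^ℕ n)  ≈⟨ interchange u (u ⁻¹) (u ^ℕ m) ((u ⁻¹) ^ℕ n) ⟩
      u * u ^ℕ m * (u ⁻¹ * (u ⁻¹) ^ℕ n)  ∎

    ^ℤ-+ : ∀ i j → u ^ℤ (i ℤ.+ j) ≈ u ^ℤ i * u ^ℤ j
    ^ℤ-+ (+ m)    (+ n)    = ^ℕ-+ u m n
    ^ℤ-+ (+ m)    -[1+ n ] = ^ℤ-⊖ m (suc n)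
    ^ℤ-+ -[1+ m ] (+ n)    = trans (^ℤ-⊖ n (suc m)) (*-comm _ _)
    ^ℤ-+ -[1+ m ] -[1+ n ] = begin
      (u ⁻¹) ^ℕ suc (suc (m ℕ.+ n))      ≡⟨ ≡.cong (λ k → (u ⁻¹) ^ℕ suc k) (ℕP.+-suc m n) ⟨
      (u ⁻¹) ^ℕ (suc m ℕ.+ suc n)        ≈⟨ ^ℕ-+ (u ⁻¹) (suc m) (suc n) ⟩
      (u ⁻¹) ^ℕ suc m * (u ⁻¹) ^ℕ suc n  ∎

    ^ℤ-+1 : ∀ n → u ^ℤ (n ℤ.+ + 1) ≈ u ^ℤ n * u
    ^ℤ-+1 n = trans (^ℤ-+ n (+ 1)) (*-congˡ (*-identityʳ u))

    ^ℤ--1 : ∀ n → u ^ℤ (n ℤ.- + 1) ≈ u ^ℤ n * u ⁻¹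
    ^ℤ--1 n = trans (^ℤ-+ n (ℤ.- + 1)) (*-congˡ (*-identityʳ (u ⁻¹)))

    ^ℤ-⁻¹ : ∀ n → (u ^ℤ n) ⁻¹ ≈ u ^ℤ (ℤ.- n)
    ^ℤ-⁻¹ n = sym (inverseʳ-unique (u ^ℤ n) (u ^ℤ (ℤ.- n)) (begin
      u ^ℤ n * u ^ℤ (ℤ.- n)  ≈⟨ ^ℤ-+ n (ℤ.- n) ⟨
      u ^ℤ (n ℤ.- n)         ≡⟨ ≡.cong (u ^ℤ_) (ℤP.+-inverseʳ n) ⟩
      1#                     ∎))

    ^ℤ-*ℕ : ∀ k n → (u ^ℤ n) ^ℕ k ≈ u ^ℤ (+ k ℤ.* n)
    ^ℤ-*ℕ zero    n = refl
    ^ℤ-*ℕ (suc k) n = begin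
      u ^ℤ n * (u ^ℤ n) ^ℕ k      ≈⟨ *-congˡ (^ℤ-*ℕ k n) ⟩
      u ^ℤ n * u ^ℤ (+ k ℤ.* n)   ≈⟨ ^ℤ-+ n (+ k ℤ.* n) ⟨
      u ^ℤ (n ℤ.+ + k ℤ.* n)      ≡⟨ ≡.cong (u ^ℤ_) (ℤP.suc-* (+ k) n) ⟨
      u ^ℤ (+ suc k ℤ.* n)        ∎

    ^ℤ-* : ∀ k n → (u ^ℤ n) ^ℤ k ≈ u ^ℤ (k ℤ.* n)
    ^ℤ-* (+ k)    n = ^ℤ-*ℕ k n
    ^ℤ-* -[1+ k ] n = begin
      ((u ^ℤ n) ⁻¹) ^ℕ suc k        ≈⟨ ^ℕ-cong (suc k) (^ℤ-⁻¹ n) ⟩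
      (u ^ℤ (ℤ.- n)) ^ℕ suc k       ≈⟨ ^ℤ-*ℕ (suc k) (ℤ.- n) ⟩
      u ^ℤ (+ suc k ℤ.* ℤ.- n)      ≡⟨ ≡.cong (u ^ℤ_) (ℤP.neg-distribʳ-* (+ suc k) n) ⟨
      u ^ℤ (ℤ.- (+ suc k ℤ.* n))    ≡⟨ ≡.cong (u ^ℤ_) (ℤP.neg-distribˡ-* (+ suc k) n) ⟩
      u ^ℤ (-[1+ k ] ℤ.* n)         ∎

  module LinearRecurrence (p q : Carrier) (q≉0 : ¬ (q ≈ 0#)) where
    open import Data.Product using (_×_; _,_; proj₁; proj₂)

    SolvesRecurrence : (ℤ → Carrier) → Set ℓ
    SolvesRecurrence H = ∀ n → H (n ℤ.+ + 1) ≈ p * H n - q * H (n ℤ.- + 1)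

    module _ (a b : Carrier) {H : ℤ → Carrier} (recurrence : SolvesRecurrence H)
      (H₀≈h₀ : H (+ 0) ≈ HoradamLucas.h₀ F a b p q) (H₁≈h₁ : H (+ 1) ≈ HoradamLucas.h₁ F a b p q) where
      open HoradamLucas F a b p q

      fwd≈ : ∀ n → proj₁ (fwd n) ≈ H (+ n) × proj₂ (fwd n) ≈ H (+ suc n)
      fwd≈ zero    = sym H₀≈h₀ , sym H₁≈h₁
      fwd≈ (suc n) = proj₂ (fwd≈ n) , (begin
        p * proj₂ (fwd n) - q * proj₁ (fwd n)  ≈⟨ +-cong (*-congˡ (proj₂ (fwd≈ n))) (-‿cong (*-congˡ (proj₁ (fwd≈ n)))) ⟩
        p * H (+ suc n) - q * H (+ n)          ≈⟨ recurrence (+ suc n) ⟨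
        H (+ suc n ℤ.+ + 1)                    ≡⟨ ≡.cong (λ k → H (+ k)) (ℕP.+-comm (suc n) 1) ⟩
        H (+ suc (suc n))                      ∎)

      bwd≈ : ∀ m → proj₁ (bwd m) ≈ H (ℤ.- + m) × proj₂ (bwd m) ≈ H (ℤ.- + m ℤ.+ + 1)
      bwd≈ zero    = sym H₀≈h₀ , sym H₁≈h₁
      bwd≈ (suc m) = (begin
        (p * proj₁ (bwd m) - proj₂ (bwd m)) / q  ≈⟨ *-congʳ (+-cong (*-congˡ (proj₁ (bwd≈ m))) (-‿cong (proj₂ (bwd≈ m)))) ⟩
        (p * H n - H (n ℤ.+ + 1)) / q            ≈⟨ *-congʳ (+-congˡ (-‿cong (recurrence n))) ⟩
        (p * H n - (p * H n - q * Hₙ₋₁)) / q     ≈⟨ *-congʳ (solve 2 (λ x y → x :- (x :- y) := y) refl (p * H n) (q * Hₙ₋₁)) ⟩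
        q * Hₙ₋₁ / q                             ≈⟨ x*y/x≈y Hₙ₋₁ q≉0 ⟩
        H (n ℤ.- + 1)                            ≡⟨ ≡.cong H (ℤP.neg-distrib-+ (+ m) (+ 1)) ⟨
        H (ℤ.- + (m ℕ.+ 1))                      ≡⟨ ≡.cong (λ k → H (ℤ.- + k)) (ℕP.+-comm m 1) ⟩
        H (ℤ.- + suc m)                          ∎) , (begin
        proj₁ (bwd m)                            ≈⟨ proj₁ (bwd≈ m) ⟩
        H (ℤ.- + m)                              ≡⟨ ≡.cong H (ℤP.⊖-swap 0 m) ⟨
        H (0 ⊖ m)                                ≡⟨ ≡.cong H (ℤP.[1+m]⊖[1+n]≡m⊖n 0 m) ⟨
        H (ℤ.- + suc m ℤ.+ + 1)                  ∎)
        where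
        n = ℤ.- + m
        Hₙ₋₁ : Carrier
        Hₙ₋₁ = H (n ℤ.- + 1)

      h≈solution : ∀ n → h n ≈ H n
      h≈solution (+ n)    = proj₁ (fwd≈ n)
      h≈solution -[1+ m ] = proj₁ (bwd≈ (suc m))

    module Binet {α β : Carrier} (α+β≈p : α + β ≈ p) (α*β≈q : α * β ≈ q) (A B : Carrier) where
      α≉0 : ¬ (α ≈ 0#)
      α≉0 = x*y≉0⇒x≉0 (λ α*β≈0 → q≉0 (trans (sym α*β≈q) α*β≈0))

      β≉0 : ¬ (β ≈ 0#)
      β≉0 = x*y≉0⇒x≉0 (λ β*α≈0 → q≉0 (trans (sym α*β≈q) (trans (*-comm α β) β*α≈0)))

      open UnitPowers α≉0 using () renaming (^ℤ-+1 to α^ℤ-+1; ^ℤ--1 to α^ℤ--1)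
      open UnitPowers β≉0 using () renaming (^ℤ-+1 to β^ℤ-+1; ^ℤ--1 to β^ℤ--1)

      q/α≈β : q / α ≈ β
      q/α≈β = trans (*-congʳ (sym α*β≈q)) (x*y/x≈y β α≉0)

      q/β≈α : q / β ≈ α
      q/β≈α = trans (*-congʳ (trans (sym α*β≈q) (*-comm α β))) (x*y/x≈y α β≉0)

      binet : ℤ → Carrier
      binet n = A * α ^ℤ n + B * β ^ℤ n

      binet-+1 : ∀ n → binet (n ℤ.+ + 1) ≈ A * (α ^ℤ n * α) + B * (β ^ℤ n * β)
      binet-+1 n = +-cong (*-congˡ (α^ℤ-+1 n)) (*-congˡ (β^ℤ-+1 n))

      q*binet--1 : ∀ n → q * binet (n ℤ.- + 1) ≈ A * (α ^ℤ n * β) + B * (β ^ℤ n * α)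
      q*binet--1 n = begin
        q * binet (n ℤ.- + 1)                         ≈⟨ *-congˡ (+-cong (*-congˡ (α^ℤ--1 n)) (*-congˡ (β^ℤ--1 n))) ⟩
        q * (A * (X * α ⁻¹) + B * (Y * β ⁻¹))         ≈⟨ solve 7 (λ q A B X Y α′ β′ → q :* (A :* (X :* α′) :+ B :* (Y :* β′))
                                                            := A :* (X :* (q :* α′)) :+ B :* (Y :* (q :* β′)))
                                                            refl q A B X Y (α ⁻¹) (β ⁻¹) ⟩
        A * (X * (q / α)) + B * (Y * (q / β))         ≈⟨ +-cong (*-congˡ (*-congˡ q/α≈β)) (*-congˡ (*-congˡ q/β≈α)) ⟩
        A * (X * β) + B * (Y * α)                     ∎
        where
        X = α ^ℤ n
        Y = β ^ℤ n

      binet-solves : SolvesRecurrence binet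
      binet-solves n = begin
        binet (n ℤ.+ + 1)                              ≈⟨ binet-+1 n ⟩
        A * (X * α) + B * (Y * β)                      ≈⟨ solve 6 (λ A B X Y α β → A :* (X :* α) :+ B :* (Y :* β)
                                                            := (α :+ β) :* (A :* X :+ B :* Y) :- (A :* (X :* β) :+ B :* (Y :* α)))
                                                            refl A B X Y α β ⟩
        (α + β) * binet n - (A * (X * β) + B * (Y * α)) ≈⟨ +-cong (*-congʳ α+β≈p) (-‿cong (sym (q*binet--1 n))) ⟩
        p * binet n - q * binet (n ℤ.- + 1)            ∎
        where
        X = α ^ℤ n
        Y = β ^ℤ n

  module QuadraticRoots (two≉0 : ¬ (fromℕ 2 ≈ 0#)) (p q d : Carrier) (d*d≈p²-4q : d * d ≈ p * p - fromℕ 4 * q) where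
    α β : Carrier
    α = (p + d) / fromℕ 2
    β = (p - d) / fromℕ 2

    private
      ½ : Carrier
      ½ = fromℕ 2 ⁻¹

      2*½≈1 : fromℕ 2 * ½ ≈ 1#
      2*½≈1 = inverseʳ (fromℕ 2) two≉0

    α+β≈p : α + β ≈ p
    α+β≈p = begin
      (p + d) * ½ + (p - d) * ½  ≈⟨ solve 3 (λ p d t → (p :+ d) :* t :+ (p :- d) :* t := p :* (con (+ 2) :* t)) refl p d ½ ⟩
      p * (fromℕ 2 * ½)          ≈⟨ *-congˡ 2*½≈1 ⟩
      p * 1#                     ≈⟨ *-identityʳ p ⟩
      p                          ∎

    α-β≈d : α - β ≈ d
    α-β≈d = begin
      (p + d) * ½ - (p - d) * ½  ≈⟨ solve 3 (λ p d t → (p :+ d) :* t :- (p :- d) :* t := d :* (con (+ 2) :* t)) refl p d ½ ⟩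
      d * (fromℕ 2 * ½)          ≈⟨ *-congˡ 2*½≈1 ⟩
      d * 1#                     ≈⟨ *-identityʳ d ⟩
      d                          ∎

    α*β≈q : α * β ≈ q
    α*β≈q = begin
      (p + d) * ½ * ((p - d) * ½)                   ≈⟨ solve 3 (λ p d t → (p :+ d) :* t :* ((p :- d) :* t) := (p :* p :- d :* d) :* (t :* t)) refl p d ½ ⟩
      (p * p - d * d) * (½ * ½)                     ≈⟨ *-congʳ (+-congˡ (-‿cong d*d≈p²-4q)) ⟩
      (p * p - (p * p - fromℕ 4 * q)) * (½ * ½)     ≈⟨ solve 3 (λ p q t → (p :* p :- (p :* p :- con (+ 4) :* q)) :* (t :* t)
                                                          := q :* ((con (+ 2) :* t) :* (con (+ 2) :* t))) refl p q ½ ⟩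
      q * (fromℕ 2 * ½ * (fromℕ 2 * ½))             ≈⟨ *-congˡ (*-cong 2*½≈1 2*½≈1) ⟩
      q * (1# * 1#)                                 ≈⟨ *-congˡ (*-identityˡ 1#) ⟩
      q * 1#                                        ≈⟨ *-identityʳ q ⟩
      q                                             ∎

  module HoradamLucasPowers (char0 : CharacteristicZero) (a b p q d : Carrier) (q≉0 : ¬ (q ≈ 0#))
    (p²-4q≉0 : ¬ (p * p - fromℕ 4 * q ≈ 0#)) (d*d≈p²-4q : d * d ≈ p * p - fromℕ 4 * q) where
    open QuadraticRoots (char0 1) p q d d*d≈p²-4q
    open LinearRecurrence p q q≉0
    open HoradamLucas F a b p q using (h; h₀; h₁)

    A B : Carrier
    A = b - a * β
    B = b - a * α

    open Binet α+β≈p α*β≈q A B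
    open UnitPowers α≉0 using (^ℤ-*)

    binet₀≈h₀ : binet (+ 0) ≈ h₀
    binet₀≈h₀ = begin
      A * 1# + B * 1#             ≈⟨ +-cong (*-identityʳ A) (*-identityʳ B) ⟩
      A + B                       ≈⟨ solve 4 (λ a b α β → (b :- a :* β) :+ (b :- a :* α) := con (+ 2) :* b :- a :* (α :+ β)) refl a b α β ⟩
      fromℕ 2 * b - a * (α + β)   ≈⟨ +-congˡ (-‿cong (*-congˡ α+β≈p)) ⟩
      h₀                          ∎

    binet₁≈h₁ : binet (+ 1) ≈ h₁
    binet₁≈h₁ = begin
      A * (α * 1#) + B * (β * 1#)              ≈⟨ +-cong (*-congˡ (*-identityʳ α)) (*-congˡ (*-identityʳ β)) ⟩
      A * α + B * β                            ≈⟨ solve 4 (λ a b α β → (b :- a :* β) :* α :+ (b :- a :* α) :* β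
                                                     := b :* (α :+ β) :- con (+ 2) :* a :* (α :* β)) refl a b α β ⟩
      b * (α + β) - fromℕ 2 * a * (α * β)      ≈⟨ +-cong (*-congˡ α+β≈p) (-‿cong (*-congˡ α*β≈q)) ⟩
      h₁                                       ∎

    h≈binet : ∀ n → h n ≈ binet n
    h≈binet = h≈solution a b binet-solves binet₀≈h₀ binet₁≈h₁

    x y : ℤ → Carrier
    x n = h (n ℤ.+ + 1) - q * h (n ℤ.- + 1)
    y n = (x n + h n * d) / (fromℕ 2 * A * d)

    x+h*d≈2Adα^ℤ : ∀ n → x n + h n * d ≈ fromℕ 2 * A * d * α ^ℤ n
    x+h*d≈2Adα^ℤ n = begin
      h (n ℤ.+ + 1) - q * h (n ℤ.- + 1) + h n * d
        ≈⟨ +-cong (+-cong (h≈binet (n ℤ.+ + 1)) (-‿cong (*-congˡ (h≈binet (n ℤ.- + 1))))) (*-cong (h≈binet n) (sym α-β≈d)) ⟩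
      binet (n ℤ.+ + 1) - q * binet (n ℤ.- + 1) + binet n * (α - β)
        ≈⟨ +-congʳ (+-cong (binet-+1 n) (-‿cong (q*binet--1 n))) ⟩
      A * (X * α) + B * (Y * β) - (A * (X * β) + B * (Y * α)) + (A * X + B * Y) * (α - β)
        ≈⟨ solve 6 (λ A B X Y α β → A :* (X :* α) :+ B :* (Y :* β) :- (A :* (X :* β) :+ B :* (Y :* α)) :+ (A :* X :+ B :* Y) :* (α :- β)
             := con (+ 2) :* A :* (α :- β) :* X) refl A B X Y α β ⟩
      fromℕ 2 * A * (α - β) * X
        ≈⟨ *-congʳ (*-congˡ α-β≈d) ⟩
      fromℕ 2 * A * d * X
        ∎
      where
      X = α ^ℤ n
      Y = β ^ℤ n

    y≈α^ℤ : ¬ (A ≈ 0#) → ∀ n → y n ≈ α ^ℤ n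
    y≈α^ℤ A≉0 n = trans (*-congʳ (x+h*d≈2Adα^ℤ n)) (x*y/x≈y (α ^ℤ n) 2Ad≉0)
      where
      d≉0 : ¬ (d ≈ 0#)
      d≉0 = x*y≉0⇒x≉0 (λ d*d≈0 → p²-4q≉0 (trans (sym d*d≈p²-4q) d*d≈0))
      2Ad≉0 : ¬ (fromℕ 2 * A * d ≈ 0#)
      2Ad≉0 = x≉0∧y≉0⇒x*y≉0 (x≉0∧y≉0⇒x*y≉0 (char0 1) A≉0) d≉0

    y^k≈y[k*n] : ¬ (A ≈ 0#) → ∀ n k → y n ^ℤ k ≈ y (k ℤ.* n)
    y^k≈y[k*n] A≉0 n k = begin
      y n ^ℤ k          ≈⟨ ^ℤ-cong k (y≈α^ℤ A≉0 n) ⟩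
      (α ^ℤ n) ^ℤ k     ≈⟨ ^ℤ-* k n ⟩
      α ^ℤ (k ℤ.* n)    ≈⟨ y≈α^ℤ A≉0 (k ℤ.* n) ⟨
      y (k ℤ.* n)       ∎

mainTheorem2 : ∀ {c ℓ} (F : Field c ℓ) → FieldOps.CharacteristicZero F →
    (a b p q d : Field.Carrier F) →
    ¬ (Field._≈_ F q (Field.0# F)) →
    ¬ (Field._≈_ F (Field._-_ F (Field._*_ F p p) (Field._*_ F (FieldOps.fromℕ F 4) q)) (Field.0# F)) →
    Field._≈_ F (Field._*_ F d d) (Field._-_ F (Field._*_ F p p) (Field._*_ F (FieldOps.fromℕ F 4) q)) →
    let open Field F
        open FieldOps F
        β = (p - d) / fromℕ 2
        A = b - a * β
        h = HoradamLucas.h F a b p q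
        x = λ (n : ℤ) → h (n ℤ.+ + 1) - q * h (n ℤ.- + 1)
        y = λ (n : ℤ) → (x n + h n * d) / (fromℕ 2 * A * d)
    in ¬ (A ≈ 0#) → ∀ (n k : ℤ) → y n ^ℤ k ≈ y (k ℤ.* n)
mainTheorem2 F char0 a b p q d q≉0 p²-4q≉0 d*d≈p²-4q =
  HoradamLucasPowers.y^k≈y[k*n] F char0 a b p q d q≉0 p²-4q≉0 d*d≈p²-4q
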